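{- Let $1\le i\le m$, $\alpha\in T$, $x,y\in V(\Gamma_i(\alpha))$ and $z\in V(\Gamma)\setminus V(\Gamma_i(\alpha))$. Suppose $(x,y)\in\Gamma_{1,p-1}$ for some $p\ge2$. If $(x,z)\in\Gamma_{1,s-1}$ for some $s\ge2$, then there exists a unique vertex $y'\in P_{(1,s-1),(p-1,1)}(y,z)$ with $y'\notin V(\Gamma_i(\alpha))$.
   Context: Digraphs have arcs as ordered pairs of distinct vertices; $\partial_\Gamma$ is directed distance, $\tilde\partial_\Gamma(x,y)=(\partial_\Gamma(x,y),\partial_\Gamma(y,x))$, $\Gamma_{a,b}=\{(x,y):\tilde\partial_\Gamma(x,y)=(a,b)\}$, $P_{\tilde i,\tilde j}(x,y)=\{z:\tilde\partial_\Gamma(x,z)=\tilde i,\tilde\partial_\Gamma(z,y)=\tilde j\}$. A strongly connected $\Gamma$ is weakly distance-regular if $|P_{\tilde i,\tilde j}(x,y)|$ depends only on $\tilde i,\tilde j,\tilde\partial_\Gamma(x,y)$; commutative if it is symmetric in $\tilde i,\tilde j$. Standing setting: $S$ is a set of $q\ge2$ elements, $d\ge1$, $\Gamma$ is a commutative weakly distance-regular digraph with vertex set $S^d$ whose underlying graph $\Sigma$ ($x\sim y$ iff $(x,y)$ or $(y,x)$ is an arc) is distance-regular with $a_1=q-2$ and $c_2=2$ (numbers of common neighbours of adjacent vertices, resp. of vertices at distance 2). Fix $o\in S$, $o_{[k]}=(o,\dots,o)$ ($k$ entries). For $1\le j\le d$, $\Gamma^{[j]}$ is the digraph on $S^j$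 with $(\beta,\gamma)$ an arc iff $((\beta,o_{[d-j]}),(\gamma,o_{[d-j]}))$ is an arc of $\Gamma$; assume that for some $1\le m\le d$ the underlying graph of $\Gamma^{[m]}$ is the Hamming graph on $S^m$. $T=S^{m-1}\times\{o_{[d-m]}\}\subseteq S^{d-1}$. For $\alpha=(a_1,\dots,a_{d-1})\in S^{d-1}$, $\Gamma_i(\alpha)$ is the induced subdigraph on $\{(a_1,\dots,a_{i-1},b,a_i,\dots,a_{d-1}):b\in S\}$. -}

module Defs where

open import Data.Nat using (ℕ; zero; suc; _+_; _∸_; _<_)
open import Data.Fin using (Fin; inject+)
import Data.Fin.Properties as FinP
open import Data.Vec using (Vec; []; _∷_; _++_; replicate; insertAt)
import Data.Vec.Properties as VecP
open import Data.List using (List; []; _∷_; concatMap; map; upTo; allFin)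
open import Data.Bool.ListAction using (any)
open import Data.Bool using (Bool; true; false; _∧_; not; if_then_else_; T)
open import Data.Product using (_×_; _,_; ∃-syntax; Σ)
open import Data.Sum using (_⊎_; inj₁; inj₂)
open import Relation.Nullary using (¬_; Dec; yes; no; does)
open import Relation.Nullary.Decidable using (_⊎-dec_)
open import Relation.Binary using (Decidable)
open import Relation.Binary.PropositionalEquality using (_≡_)
open import Function.Bundles using (_⇔_)

-- Vertices: S^n with S = Fin q (a fixed q-element set).
Vertex : ℕ → ℕ → Set
Vertex q n = Vec (Fin q) n

allVec : (q n : ℕ) → List (Vertex q n)
allVec q zero = [] ∷ []
allVec q (suc n) = concatMap (λ a → map (a ∷_) (allVec q n)) (allFin q)

_≟V_ : {q n : ℕ} → Decidable {A = Vertex q n} _≡_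
_≟V_ = VecP.≡-dec FinP._≟_

record Digraph (q n : ℕ) : Set₁ where
  field
    Arc    : Vertex q n → Vertex q n → Set
    arc?   : Decidable Arc
    irrefl : (x : Vertex q n) → ¬ Arc x x

underlying : {q n : ℕ} → Digraph q n → Digraph q n
underlying Γ = record
  { Arc    = λ x y → Arc x y ⊎ Arc y x
  ; arc?   = λ x y → arc? x y ⊎-dec arc? y x
  ; irrefl = λ { x (inj₁ a) → irrefl x a ; x (inj₂ a) → irrefl x a } }
  where open Digraph Γ

module _ {q n : ℕ} (Γ : Digraph q n) where
  open Digraph Γ

  adjB : Vertex q n → Vertex q n → Bool
  adjB x y = does (arc? x y)

  walkB : ℕ → Vertex q n → Vertex q n → Bool
  walkB zero x y = does (x ≟V y)
  walkB (suc k) x y = any (λ z → adjB x z ∧ walkB k z y) (allVec q n)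

  isDist : ℕ → Vertex q n → Vertex q n → Bool
  isDist a x y = walkB a x y ∧ not (any (λ k → walkB k x y) (upTo a))

  Dist : ℕ → Vertex q n → Vertex q n → Set
  Dist a x y = T (isDist a x y)

  DDist : ℕ × ℕ → Vertex q n → Vertex q n → Set
  DDist (a , b) x y = Dist a x y × Dist b y x

  isDDist : ℕ × ℕ → Vertex q n → Vertex q n → Bool
  isDDist (a , b) x y = isDist a x y ∧ isDist b y x

  countV : (Vertex q n → Bool) → ℕ
  countV f = go (allVec q n)
    where
    go : List (Vertex q n) → ℕ
    go [] = 0
    go (v ∷ vs) = if f v then suc (go vs) else go vs

  pCount : ℕ × ℕ → ℕ × ℕ → Vertex q n → Vertex q n → ℕ
  pCount i j x y = countV (λ z → isDDist i x z ∧ isDDist j z y)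

  StronglyConnected : Set
  StronglyConnected = (x y : Vertex q n) → ∃[ k ] T (walkB k x y)

  WeaklyDistanceRegular : Set
  WeaklyDistanceRegular =
    StronglyConnected ×
    ((h i j : ℕ × ℕ) (x y x' y' : Vertex q n) →
       DDist h x y → DDist h x' y' → pCount i j x y ≡ pCount i j x' y')

  Commutative : Set
  Commutative = (i j : ℕ × ℕ) (x y : Vertex q n) → pCount i j x y ≡ pCount j i x y

  interCount : ℕ → Vertex q n → Vertex q n → ℕ
  interCount k x y = countV (λ z → isDist k x z ∧ adjB z y)

  DistanceRegular : Set
  DistanceRegular =
    StronglyConnected ×
    ((h : ℕ) (x y x' y' : Vertex q n) → Dist h x y → Dist h x' y' →
       (interCount (h ∸ 1) x y ≡ interCount (h ∸ 1) x' y') ×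
       (interCount h x y ≡ interCount h x' y') ×
       (interCount (suc h) x y ≡ interCount (suc h) x' y'))

  Has-a₁ : ℕ → Set
  Has-a₁ a = (x y : Vertex q n) → Dist 1 x y → interCount 1 x y ≡ a

  Has-c₂ : ℕ → Set
  Has-c₂ c = (x y : Vertex q n) → Dist 2 x y → interCount 1 x y ≡ c

hamDist : {q n : ℕ} → Vertex q n → Vertex q n → ℕ
hamDist [] [] = 0
hamDist (a ∷ as) (b ∷ bs) with a FinP.≟ b
... | yes _ = hamDist as bs
... | no _  = suc (hamDist as bs)

-- Here d = m + e with m = suc m'.  The padding (β, o_[d-m]).
pad : {q m e : ℕ} → Fin q → Vertex q m → Vertex q (m + e)
pad {e = e} o β = β ++ replicate e o

ArcTop : {q m e : ℕ} → Digraph q (m + e) → Fin q → Vertex q m → Vertex q m → Set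
ArcTop Γ o β γ = Digraph.Arc Γ (pad o β) (pad o γ)

TopIsHamming : {q m e : ℕ} → Digraph q (m + e) → Fin q → Set
TopIsHamming {q} {m} Γ o =
  (β γ : Vertex q m) → (ArcTop Γ o β γ ⊎ ArcTop Γ o γ β) ⇔ (hamDist β γ ≡ 1)

-- Vertex set of Γ_i(α) for α ∈ S^{d-1} and 0-based insertion position k (k = i - 1):
-- {(a_1,...,a_{i-1}, b, a_i, ..., a_{d-1}) : b ∈ S}
InLayer : {q n : ℕ} → Fin (suc n) → Vertex q n → Vertex q (suc n) → Set
InLayer {q} k α x = ∃[ b ] (x ≡ insertAt α k b)

{-# OPTIONS --safe #-}
-- The layer Γᵢ(α) is a q-clique of Σ (Γ^[m] has the Hamming graph as underlying
-- graph), and as a₁ = q − 2 no vertex outside it is adjacent to two of its vertices.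
-- Hence y and z lie at distance 2 in Σ; by c₂ = 2 they have exactly two common
-- neighbours, one of which is x. Every admissible y′ is a common neighbour outside
-- the layer, so there is at most one. For existence, commutativity turns
-- x ∈ P_{(p−1,1),(1,s−1)}(y,z) into a vertex of P_{(1,s−1),(p−1,1)}(y,z), which
-- differs from x unless p = s = 2. In that case xy and xz are undirected edges, and
-- commutativity together with c₂ = 2 shows that the second common neighbour w of
-- y and z is joined to both by undirected edges as well.
module Submission where

open import Defs
open import Data.Nat using (ℕ; suc; _+_; _∸_; _≤_)
open import Data.Fin using (Fin; _↑ˡ_)
open import Data.Vec using (Vec; _++_; replicate)
open import Data.Product using (_×_; _,_; ∃!)
open import Relation.Nullary using (¬_)
open import Relation.Binary.PropositionalEquality using (_≡_)

open import Data.Nat using (zero; _<_; z≤n; s≤s)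
open import Data.Nat.Properties using (≤-trans; ≤-reflexive; <-irrefl; <-cmp; _≟_)
open import Data.Nat.Induction using (<-rec)
open import Data.Fin using (zero; suc; punchIn; punchOut)
import Data.Fin as Fin
open import Data.Fin.Properties using (punchIn-injective; punchInᵢ≢i; punchIn-punchOut)
open import Data.Vec using (insertAt; lookup)
open import Data.Vec.Properties using (insertAt-lookup; ∷-injectiveˡ; ∷-injectiveʳ)
open import Data.Product using (∃; proj₁; proj₂; swap)
open import Data.Sum using (_⊎_; inj₁; inj₂)
import Data.Sum as Sum
open import Data.Empty using (⊥; ⊥-elim)
open import Data.Bool using (Bool; true; false; not; _∧_; T; if_then_else_)
open import Data.Bool.Properties using (T-∧)
open import Data.Bool.ListAction using (any)
open import Data.List using (List; []; _∷_; [_]; length; filter; map; concatMap; tabulate; upTo; allFin; cartesianProductWith)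
import Data.List as List
open import Data.List.Properties using (length-++-sucʳ; length-tabulate)
open import Data.List.Membership.Propositional using (_∈_; lose; find)
open import Data.List.Membership.Propositional.Properties
  using (∈-∃++; ∈-++⁻; ∈-++⁺ˡ; ∈-++⁺ʳ; ∈-filter⁺; ∈-filter⁻; ∈-cartesianProductWith⁺; ∈-allFin; ∈-upTo⁺; ∈-upTo⁻)
open import Data.List.Relation.Binary.Subset.Propositional using (_⊆_)
open import Data.List.Relation.Unary.Any using (here; there; any?; satisfied)
open import Data.List.Relation.Unary.Any.Properties using (any⁺; any⁻)
open import Data.List.Relation.Unary.All as All using (All)
open import Data.List.Relation.Unary.All.Properties using (tabulate⁺)
open import Data.List.Relation.Unary.AllPairs using ([]; _∷_)
open import Data.List.Relation.Unary.Unique.Propositional using (Unique)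
import Data.List.Relation.Unary.Unique.Propositional.Properties as Unique
open import Function using (_∘_; Injective)
open import Function.Bundles using (Equivalence)
open import Relation.Nullary using (Dec; yes; no; does; contradiction)
open import Relation.Nullary.Decidable using (T?; _×-dec_; ¬?)
open import Relation.Binary.PropositionalEquality using (refl; sym; trans; cong; cong₂; subst; subst₂; _≢_)
open import Relation.Binary.Definitions using (tri<; tri≈; tri>)

open Equivalence using (to; from)

¬T⇒T-not : ∀ {b} → ¬ T b → T (not b)
¬T⇒T-not {false} _ = _
¬T⇒T-not {true} ¬t = ¬t _

T-not⇒¬T : ∀ {b} → T (not b) → ¬ T b
T-not⇒¬T {false} _ ()

T-does⁺ : {A : Set} (a? : Dec A) → A → T (does a?)
T-does⁺ (yes _) _ = _
T-does⁺ (no ¬a) a = ¬a a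

T-does⁻ : {A : Set} (a? : Dec A) → T (does a?) → A
T-does⁻ (yes a) _ = a

module _ {A : Set} where

  Unique-⊆⇒length-≤ : {xs ys : List A} → Unique xs → xs ⊆ ys → length xs ≤ length ys
  Unique-⊆⇒length-≤ {[]} _ _ = z≤n
  Unique-⊆⇒length-≤ {x ∷ xs} (x∉xs ∷ xs!) xs⊆ys with ∈-∃++ (xs⊆ys (here refl))
  ... | as , bs , refl =
    ≤-trans (s≤s (Unique-⊆⇒length-≤ xs! xs⊆as++bs)) (≤-reflexive (sym (length-++-sucʳ as x bs)))
    where
    xs⊆as++bs : xs ⊆ as List.++ bs
    xs⊆as++bs v∈xs with ∈-++⁻ as (xs⊆ys (there v∈xs))
    ... | inj₁ v∈as = ∈-++⁺ˡ v∈as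
    ... | inj₂ (here refl) = contradiction refl (All.lookup x∉xs v∈xs)
    ... | inj₂ (there v∈bs) = ∈-++⁺ʳ as v∈bs

  -- countV is defined through a local recursion that cannot be named, so it is
  -- identified with length ∘ filter through its defining equations.
  length-filter-by-recursion : (f : A → Bool) {count : List A → ℕ} → count [] ≡ 0
    → (∀ v vs → count (v ∷ vs) ≡ (if f v then suc (count vs) else count vs))
    → ∀ vs → count vs ≡ length (filter (T? ∘ f) vs)
  length-filter-by-recursion f nil cons [] = nil
  length-filter-by-recursion f nil cons (v ∷ vs) with f v | cons v vs
  ... | true  | eq = trans eq (cong suc (length-filter-by-recursion f nil cons vs))
  ... | false | eq = trans eq (length-filter-by-recursion f nil cons vs)

concatMap-map≡cartesianProductWith : {A B C : Set} (f : A → B → C) (xs : List A) (ys : List B)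
  → concatMap (λ x → map (f x) ys) xs ≡ cartesianProductWith f xs ys
concatMap-map≡cartesianProductWith f [] ys = refl
concatMap-map≡cartesianProductWith f (x ∷ xs) ys =
  cong (map (f x) ys List.++_) (concatMap-map≡cartesianProductWith f xs ys)

∈-allVec : ∀ {q n} (v : Vertex q n) → v ∈ allVec q n
∈-allVec {n = zero} Vec.[] = here refl
∈-allVec {q} {suc n} (a Vec.∷ v)
  rewrite concatMap-map≡cartesianProductWith Vec._∷_ (allFin q) (allVec q n) =
  ∈-cartesianProductWith⁺ Vec._∷_ (∈-allFin a) (∈-allVec v)

allVec-Unique : ∀ q n → Unique (allVec q n)
allVec-Unique q zero = All.[] ∷ []
allVec-Unique q (suc n)
  rewrite concatMap-map≡cartesianProductWith Vec._∷_ (allFin q) (allVec q n) =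
  Unique.cartesianProductWith⁺ Vec._∷_ (λ eq → ∷-injectiveˡ eq , ∷-injectiveʳ eq)
    (Unique.allFin⁺ q) (allVec-Unique q n)

module _ {q n : ℕ} (Γ : Digraph q n) (f : Vertex q n → Bool) where

  countV≡length-filter : countV Γ f ≡ length (filter (T? ∘ f) (allVec q n))
  countV≡length-filter with length-filter-by-recursion f refl (λ _ _ → refl) | allVec q n
  ... | by-recursion | vs = by-recursion vs

  countV-≥ : {vs : List (Vertex q n)} → Unique vs → All (T ∘ f) vs
    → length vs ≤ countV Γ f
  countV-≥ {vs} vs! fvs = subst (length vs ≤_) (sym countV≡length-filter)
    (Unique-⊆⇒length-≤ vs! (λ v∈vs → ∈-filter⁺ (T? ∘ f) (∈-allVec _) (All.lookup fvs v∈vs)))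

  countV-≤ : {vs : List (Vertex q n)} → (∀ {v} → T (f v) → v ∈ vs) → countV Γ f ≤ length vs
  countV-≤ {vs} f⊆vs = subst (_≤ length vs) (sym countV≡length-filter)
    (Unique-⊆⇒length-≤ (Unique.filter⁺ (T? ∘ f) (allVec-Unique q n))
      (λ v∈ → f⊆vs (proj₂ (∈-filter⁻ (T? ∘ f) {xs = allVec q n} v∈))))

  countV-pos⇒∃ : 1 ≤ countV Γ f → ∃ (T ∘ f)
  countV-pos⇒∃ 1≤count with any? (T? ∘ f) (allVec q n)
  ... | yes some = satisfied some
  ... | no none = contradiction (≤-trans 1≤count (countV-≤ {[]} unsatisfiable)) λ ()
    where
    unsatisfiable : ∀ {v} → T (f v) → v ∈ []
    unsatisfiable {v} fv = ⊥-elim (none (lose (∈-allVec v) fv))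

module _ {q n : ℕ} (G : Digraph q n) where
  open Digraph G

  Arc⇒walk1 : ∀ {x y} → Arc x y → T (walkB G 1 x y)
  Arc⇒walk1 {x} {y} xy = any⁺ (λ v → adjB G x v ∧ walkB G 0 v y)
    (lose (∈-allVec y) (from (T-∧ {adjB G x y}) (T-does⁺ (arc? x y) xy , T-does⁺ (y ≟V y) refl)))

  walk1⇒Arc : ∀ {x y} → T (walkB G 1 x y) → Arc x y
  walk1⇒Arc {x} {y} w
    with z , _ , t ← find (any⁻ (λ z → adjB G x z ∧ walkB G 0 z y) (allVec q n) w)
    with xz , zy ← to (T-∧ {adjB G x z}) t =
    subst (Arc x) (T-does⁻ (z ≟V y) zy) (T-does⁻ (arc? x z) xz)

  Dist⇒walk : ∀ {k x y} → Dist G k x y → T (walkB G k x y)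
  Dist⇒walk {k} {x} {y} = proj₁ ∘ to (T-∧ {walkB G k x y})

  Dist⇒no-shorter-walk : ∀ {k j x y} → Dist G k x y → j < k → ¬ T (walkB G j x y)
  Dist⇒no-shorter-walk {k} {j} {x} {y} d j<k w =
    T-not⇒¬T (proj₂ (to (T-∧ {walkB G k x y}) d)) (any⁺ (λ i → walkB G i x y) (lose (∈-upTo⁺ j<k) w))

  Dist1⇒Arc : ∀ {x y} → Dist G 1 x y → Arc x y
  Dist1⇒Arc {x} {y} d = walk1⇒Arc (Dist⇒walk {1} {x} {y} d)

  Arc⇒Dist1 : ∀ {x y} → Arc x y → Dist G 1 x y
  Arc⇒Dist1 {x} {y} xy = from (T-∧ {walkB G 1 x y}) (Arc⇒walk1 xy , ¬T⇒T-not no-walk0)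
    where
    no-walk0 : ¬ T (any (λ j → walkB G j x y) (upTo 1))
    no-walk0 w with _ , here refl , w0 ← find (any⁻ (λ j → walkB G j x y) (upTo 1) w) =
      irrefl x (subst (Arc x) (sym (T-does⁻ (x ≟V y) w0)) xy)

  Dist-functional : ∀ {a b x y} → Dist G a x y → Dist G b x y → a ≡ b
  Dist-functional {a} {b} {x} {y} da db with <-cmp a b
  ... | tri< a<b _ _ = contradiction (Dist⇒walk {a} {x} {y} da) (Dist⇒no-shorter-walk {b} db a<b)
  ... | tri≈ _ a≡b _ = a≡b
  ... | tri> _ _ b<a = contradiction (Dist⇒walk {b} {x} {y} db) (Dist⇒no-shorter-walk {a} da b<a)

  DDist-functional : ∀ {s t x y} → DDist G s x y → DDist G t x y → s ≡ t
  DDist-functional {s₁ , s₂} {t₁ , t₂} {x} {y} (d₁ , d₂) (e₁ , e₂) =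
    cong₂ _,_ (Dist-functional {s₁} {t₁} {x} {y} d₁ e₁) (Dist-functional {s₂} {t₂} {y} {x} d₂ e₂)

  walk⇒∃Dist : ∀ {x y} k → T (walkB G k x y) → ∃ λ a → Dist G a x y
  walk⇒∃Dist {x} {y} = <-rec _ shortest
    where
    shortest : ∀ k → (∀ {j} → j < k → T (walkB G j x y) → ∃ λ a → Dist G a x y)
      → T (walkB G k x y) → ∃ λ a → Dist G a x y
    shortest k rec w with T? (any (λ j → walkB G j x y) (upTo k))
    ... | no none = k , from (T-∧ {walkB G k x y}) (w , ¬T⇒T-not none)
    ... | yes some with j , j∈ , wj ← find (any⁻ (λ j → walkB G j x y) (upTo k) some) =
      rec (∈-upTo⁻ j∈) wj

  StronglyConnected⇒∃DDist : StronglyConnected G → ∀ x y → ∃ λ t → DDist G t x y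
  StronglyConnected⇒∃DDist sc x y
    with a , dxy ← walk⇒∃Dist {x} {y} (proj₁ (sc x y)) (proj₂ (sc x y))
    with b , dyx ← walk⇒∃Dist {y} {x} (proj₁ (sc y x)) (proj₂ (sc y x)) =
    (a , b) , dxy , dyx

  Dist2-intro : ∀ {x y z} → x ≢ y → ¬ Arc x y → Arc x z → Arc z y → Dist G 2 x y
  Dist2-intro {x} {y} {z} x≢y ¬xy xz zy = from (T-∧ {walkB G 2 x y}) (walk2 , ¬T⇒T-not no-shorter)
    where
    walk2 : T (walkB G 2 x y)
    walk2 = any⁺ (λ v → adjB G x v ∧ walkB G 1 v y)
      (lose (∈-allVec z) (from (T-∧ {adjB G x z}) (T-does⁺ (arc? x z) xz , Arc⇒walk1 zy)))
    no-shorter : ¬ T (any (λ j → walkB G j x y) (upTo 2))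
    no-shorter w with find (any⁻ (λ j → walkB G j x y) (upTo 2) w)
    ... | _ , here refl , w0 = x≢y (T-does⁻ (x ≟V y) w0)
    ... | _ , there (here refl) , w1 = ¬xy (walk1⇒Arc w1)

module _ {q n : ℕ} (Γ : Digraph q n) where

  pCount-pos : ∀ {s t x y} w → DDist Γ s x w → DDist Γ t w y → 1 ≤ pCount Γ s t x y
  pCount-pos {s₁ , s₂} {t₁ , t₂} {x} {y} w xw wy = countV-≥ Γ _ (All.[] ∷ []) (w∈P All.∷ All.[])
    where
    w∈P : T (isDDist Γ (s₁ , s₂) x w ∧ isDDist Γ (t₁ , t₂) w y)
    w∈P = from (T-∧ {isDDist Γ (s₁ , s₂) x w})
      (from (T-∧ {isDist Γ s₁ x w}) xw , from (T-∧ {isDist Γ t₁ w y}) wy)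

  pCount-pos⇒∃ : ∀ {s t x y} → 1 ≤ pCount Γ s t x y → ∃ λ w → DDist Γ s x w × DDist Γ t w y
  pCount-pos⇒∃ {s₁ , s₂} {t₁ , t₂} {x} {y} 1≤count with w , sw ← countV-pos⇒∃ Γ _ 1≤count
    with xw , wy ← to (T-∧ {isDDist Γ (s₁ , s₂) x w}) sw =
    w , to (T-∧ {isDist Γ s₁ x w}) xw , to (T-∧ {isDist Γ t₁ w y}) wy

  Commutative⇒swap : Commutative Γ → ∀ {s t x y} w → DDist Γ s x w → DDist Γ t w y
    → ∃ λ w′ → DDist Γ t x w′ × DDist Γ s w′ y
  Commutative⇒swap comm {s} {t} {x} {y} w xw wy =
    pCount-pos⇒∃ {t} {s} (subst (1 ≤_) (comm s t x y) (pCount-pos {s} {t} w xw wy))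

module _ {q n : ℕ} (G : Digraph q n) where
  open Digraph G

  CommonNeighbour : Vertex q n → Vertex q n → Vertex q n → Set
  CommonNeighbour u v w = Arc u w × Arc w v

  private
    T-common⁺ : ∀ {u v w} → CommonNeighbour u v w → T (isDist G 1 u w ∧ adjB G w v)
    T-common⁺ {u} {v} {w} (uw , wv) =
      from (T-∧ {isDist G 1 u w}) (Arc⇒Dist1 G uw , T-does⁺ (arc? w v) wv)

    T-common⁻ : ∀ {u v w} → T (isDist G 1 u w ∧ adjB G w v) → CommonNeighbour u v w
    T-common⁻ {u} {v} {w} t with uw , wv ← to (T-∧ {isDist G 1 u w}) t =
      Dist1⇒Arc G uw , T-does⁻ (arc? w v) wv

  common-neighbours-≥ : ∀ {u v ws} → Unique ws → All (CommonNeighbour u v) ws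
    → length ws ≤ interCount G 1 u v
  common-neighbours-≥ ws! common = countV-≥ G _ ws! (All.map T-common⁺ common)

  common-neighbours-≤ : ∀ {u v ws} → (∀ {w} → CommonNeighbour u v w → w ∈ ws)
    → interCount G 1 u v ≤ length ws
  common-neighbours-≤ ⊆ws = countV-≤ G _ (⊆ws ∘ T-common⁻)

  module _ (c₂ : Has-c₂ G 2) {u v : Vertex q n} (uv : Dist G 2 u v) where

    no-three-common-neighbours : ∀ {a b c} → a ≢ b → a ≢ c → b ≢ c
      → CommonNeighbour u v a → CommonNeighbour u v b → CommonNeighbour u v c → ⊥
    no-three-common-neighbours a≢b a≢c b≢c na nb nc = contradiction (subst (3 ≤_) (c₂ u v uv)
      (common-neighbours-≥ ((a≢b All.∷ a≢c All.∷ All.[]) ∷ (b≢c All.∷ All.[]) ∷ All.[] ∷ [])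
        (na All.∷ nb All.∷ nc All.∷ All.[]))) λ { (s≤s (s≤s ())) }

    another-common-neighbour : ∀ {a} → CommonNeighbour u v a → ∃ λ w → w ≢ a × CommonNeighbour u v w
    another-common-neighbour {a} na
      with any? (λ w → T? (isDist G 1 u w ∧ adjB G w v) ×-dec ¬? (w ≟V a)) (allVec q n)
    ... | yes some with w , nw , w≢a ← satisfied some = w , w≢a , T-common⁻ nw
    ... | no none = contradiction (subst (_≤ 1) (c₂ u v uv) (common-neighbours-≤ only-a)) λ { (s≤s ()) }
      where
      only-a : ∀ {w} → CommonNeighbour u v w → w ∈ [ a ]
      only-a {w} nw with w ≟V a
      ... | yes w≡a = here w≡a
      ... | no w≢a = ⊥-elim (none (lose (∈-allVec w) (T-common⁺ nw , w≢a)))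

avoiding-two : ∀ {k} {a b : Fin k} → a ≢ b
  → ∃ λ (g : Fin (k ∸ 2) → Fin k) → Injective _≡_ _≡_ g × (∀ j → g j ≢ a × g j ≢ b)
avoiding-two {suc zero} {zero} {zero} a≢b = contradiction refl a≢b
avoiding-two {suc (suc k)} {a} {b} a≢b = g , g-injective , avoids
  where
  b′ : Fin (suc k)
  b′ = punchOut a≢b
  g : Fin k → Fin (suc (suc k))
  g j = punchIn a (punchIn b′ j)
  g-injective : Injective _≡_ _≡_ g
  g-injective eq = punchIn-injective b′ _ _ (punchIn-injective a _ _ eq)
  avoids : ∀ j → g j ≢ a × g j ≢ b
  avoids j = punchInᵢ≢i a _
           , λ gj≡b → punchInᵢ≢i b′ j (punchIn-injective a _ _ (trans gj≡b (sym (punchIn-punchOut a≢b))))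

module _ {q n : ℕ} (G : Digraph q n) {k : ℕ} (a₁ : Has-a₁ G (k ∸ 2))
  (f : Fin k → Vertex q n) (f-injective : Injective _≡_ _≡_ f)
  (clique : ∀ {b c} → b ≢ c → Digraph.Arc G (f b) (f c)) where
  open Digraph G

  -- Two vertices of the k-clique already share the k − 2 others as common
  -- neighbours, which exhausts a₁.
  clique-outsider-has-one-neighbour : ∀ {b c t} → b ≢ c → (∀ d → t ≢ f d) → Arc (f b) t → Arc t (f c) → ⊥
  clique-outsider-has-one-neighbour {b} {c} {t} b≢c outside bt tc
    with g , g-injective , g-avoids ← avoiding-two b≢c =
    contradiction (subst (suc (k ∸ 2) ≤_) (a₁ (f b) (f c) (Arc⇒Dist1 G (clique b≢c))) too-many) (<-irrefl refl)
    where
    common-neighbour : ∀ j → CommonNeighbour G (f b) (f c) (f (g j))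
    common-neighbour j = clique (proj₁ (g-avoids j) ∘ sym) , clique (proj₂ (g-avoids j))
    too-many : suc (k ∸ 2) ≤ interCount G 1 (f b) (f c)
    too-many = subst (_≤ interCount G 1 (f b) (f c)) (cong suc (length-tabulate (f ∘ g)))
      (common-neighbours-≥ G
        (tabulate⁺ (outside ∘ g) ∷ Unique.tabulate⁺ (g-injective ∘ f-injective))
        ((bt , tc) All.∷ tabulate⁺ common-neighbour))

insertAt-++ : ∀ {A : Set} {m e} (β : Vec A m) (i : Fin (suc m)) (r : Vec A e) b →
  insertAt (β ++ r) (i ↑ˡ e) b ≡ insertAt β i b ++ r
insertAt-++ Vec.[] zero r b = refl
insertAt-++ (x Vec.∷ β) zero r b = refl
insertAt-++ (x Vec.∷ β) (suc i) r b = cong (x Vec.∷_) (insertAt-++ β i r b)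

insertAt-injective : ∀ {A : Set} {m} (β : Vec A m) (i : Fin (suc m)) {b c}
  → insertAt β i b ≡ insertAt β i c → b ≡ c
insertAt-injective β i {b} {c} eq =
  trans (sym (insertAt-lookup β i b)) (trans (cong (λ v → lookup v i) eq) (insertAt-lookup β i c))

hamDist-refl : ∀ {q n} (v : Vertex q n) → hamDist v v ≡ 0
hamDist-refl Vec.[] = refl
hamDist-refl (a Vec.∷ v) with a Fin.≟ a
... | yes _ = hamDist-refl v
... | no a≢a = contradiction refl a≢a

hamDist-insertAt : ∀ {q m} (β : Vertex q m) (i : Fin (suc m)) {b c} → b ≢ c →
  hamDist (insertAt β i b) (insertAt β i c) ≡ 1
hamDist-insertAt β zero {b} {c} b≢c with b Fin.≟ c
... | yes b≡c = contradiction b≡c b≢c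
... | no _ = cong suc (hamDist-refl β)
hamDist-insertAt (a Vec.∷ β) (suc i) b≢c with a Fin.≟ a
... | yes _ = hamDist-insertAt β i b≢c
... | no a≢a = contradiction refl a≢a

module _ {q n : ℕ} (Γ : Digraph q n) where
  open Digraph (underlying Γ) using () renaming (Arc to _~_)

  adjacent⇒DDist-has-1 : ∀ {a b u v} → DDist Γ (a , b) u v → u ~ v → a ≡ 1 ⊎ b ≡ 1
  adjacent⇒DDist-has-1 {a} {b} {u} {v} (uv , _) (inj₁ u→v) =
    inj₁ (Dist-functional Γ {a} {1} {u} {v} uv (Arc⇒Dist1 Γ u→v))
  adjacent⇒DDist-has-1 {a} {b} {u} {v} (_ , vu) (inj₂ v→u) =
    inj₂ (Dist-functional Γ {b} {1} {v} {u} vu (Arc⇒Dist1 Γ v→u))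

  DDist-has-1⇒adjacent : ∀ {a b u v} → DDist Γ (a , b) u v → a ≡ 1 ⊎ b ≡ 1 → u ~ v
  DDist-has-1⇒adjacent (uv , vu) (inj₁ refl) = inj₁ (Dist1⇒Arc Γ uv)
  DDist-has-1⇒adjacent (uv , vu) (inj₂ refl) = inj₂ (Dist1⇒Arc Γ vu)

module _ {q n : ℕ} {Γ : Digraph q n} (sc : StronglyConnected Γ) (comm : Commutative Γ)
  (c₂ : Has-c₂ (underlying Γ) 2) where
  private
    Σ : Digraph q n
    Σ = underlying Γ

  -- With t = ∂̃(r, w), commutativity yields a common neighbour c of x and w
  -- with ∂̃(x, c) = t; since c₂ = 2, c is r or r′, whence t = (1, 1).
  undirected-edge-propagates : ∀ {x w r r′} → Dist Σ 2 x w → r ≢ r′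
    → CommonNeighbour Σ x w r → CommonNeighbour Σ x w r′
    → DDist Γ (1 , 1) x r → DDist Γ (1 , 1) x r′ → DDist Γ (1 , 1) r w
  undirected-edge-propagates {x} {w} {r} {r′} xw r≢r′ common common′ x→r x→r′
    with (t₁ , t₂) , r→w ← StronglyConnected⇒∃DDist Γ sc r w
    with c , x→c , c→w ← Commutative⇒swap Γ comm {1 , 1} {t₁ , t₂} r x→r r→w =
    subst (λ t → DDist Γ t r w) t≡11 r→w
    where
    c-common : CommonNeighbour Σ x w c
    c-common = DDist-has-1⇒adjacent Γ {t₁} {t₂} {x} {c} x→c
                 (adjacent⇒DDist-has-1 Γ {t₁} {t₂} {r} {w} r→w (proj₂ common))
             , inj₁ (Dist1⇒Arc Γ {c} {w} (proj₁ c→w))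
    t≡11 : (t₁ , t₂) ≡ (1 , 1)
    t≡11 with c ≟V r | c ≟V r′
    ... | yes refl | _ = DDist-functional Γ {t₁ , t₂} {1 , 1} {x} {c} x→c x→r
    ... | no _ | yes refl = DDist-functional Γ {t₁ , t₂} {1 , 1} {x} {c} x→c x→r′
    ... | no c≢r | no c≢r′ =
      ⊥-elim (no-three-common-neighbours Σ c₂ xw r≢r′ (c≢r ∘ sym) (c≢r′ ∘ sym) common common′ c-common)

module Layer {q m' e : ℕ} (o : Fin q) (Γ : Digraph q (suc m' + e))
  (hamming : TopIsHamming {q} {suc m'} {e} Γ o) (a₁ : Has-a₁ (underlying Γ) (q ∸ 2))
  (i : Fin (suc m')) (β : Vec (Fin q) m') where
  private
    α : Vec (Fin q) (m' + e)
    α = β ++ replicate e o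
  open Digraph (underlying Γ) using () renaming (Arc to _~_)

  InΓᵢα : Vertex q (suc m' + e) → Set
  InΓᵢα = InLayer (i ↑ˡ e) α

  layer : Fin q → Vertex q (suc m' + e)
  layer = insertAt α (i ↑ˡ e)

  layer-clique : ∀ {b c} → b ≢ c → layer b ~ layer c
  layer-clique {b} {c} b≢c =
    subst₂ _~_ (sym (insertAt-++ β i (replicate e o) b)) (sym (insertAt-++ β i (replicate e o) c))
      (from (hamming (insertAt β i b) (insertAt β i c)) (hamDist-insertAt β i b≢c))

  layer-outsider-has-one-neighbour : ∀ {u v t} → InΓᵢα u → InΓᵢα v → u ≢ v → ¬ InΓᵢα t
    → u ~ t → v ~ t → ⊥
  layer-outsider-has-one-neighbour (b , refl) (c , refl) u≢v t∉ ut vt =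
    clique-outsider-has-one-neighbour (underlying Γ) a₁ layer (insertAt-injective α (i ↑ˡ e)) layer-clique
      (u≢v ∘ cong layer) (λ d t≡ → t∉ (d , t≡)) ut (Sum.swap vt)

module Configuration {q m' e : ℕ} {o : Fin q} {Γ : Digraph q (suc m' + e)}
  (sc : StronglyConnected Γ) (comm : Commutative Γ)
  (a₁ : Has-a₁ (underlying Γ) (q ∸ 2)) (c₂ : Has-c₂ (underlying Γ) 2)
  (hamming : TopIsHamming {q} {suc m'} {e} Γ o) {i : Fin (suc m')} {β : Vec (Fin q) m'}
  {x y z : Vertex q (suc m' + e)}
  (x∈ : InLayer (i ↑ˡ e) (β ++ replicate e o) x) (y∈ : InLayer (i ↑ˡ e) (β ++ replicate e o) y)
  (z∉ : ¬ InLayer (i ↑ˡ e) (β ++ replicate e o) z)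
  {a b : ℕ} (x→y : DDist Γ (1 , a) x y) (x→z : DDist Γ (1 , b) x z) where
  open Layer o Γ hamming a₁ i β
  open Digraph (underlying Γ) using () renaming (Arc to _~_)
  private
    Σ : Digraph q (suc m' + e)
    Σ = underlying Γ
    xy : Digraph.Arc Γ x y
    xy = Dist1⇒Arc Γ {x} {y} (proj₁ x→y)
    xz : Digraph.Arc Γ x z
    xz = Dist1⇒Arc Γ {x} {z} (proj₁ x→z)

  x≢y : x ≢ y
  x≢y refl = Digraph.irrefl Γ x xy

  y≢z : y ≢ z
  y≢z refl = z∉ y∈

  y≁z : ¬ y ~ z
  y≁z = layer-outsider-has-one-neighbour x∈ y∈ x≢y z∉ (inj₁ xz)

  y-z-distance-2 : Dist Σ 2 y z
  y-z-distance-2 = Dist2-intro Σ y≢z y≁z (inj₂ xy) (inj₁ xz)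

  Candidate : Vertex q (suc m' + e) → Set
  Candidate y′ = (DDist Γ (1 , b) y y′ × DDist Γ (a , 1) y′ z) × ¬ InΓᵢα y′

  candidate-common-neighbour : ∀ {y′} → Candidate y′ → CommonNeighbour Σ y z y′
  candidate-common-neighbour {y′} ((y→y′ , y′→z) , _) =
    inj₁ (Dist1⇒Arc Γ {y} {y′} (proj₁ y→y′)) , inj₂ (Dist1⇒Arc Γ {z} {y′} (proj₂ y′→z))

  candidate-unique : ∀ {y₁ y₂} → Candidate y₁ → Candidate y₂ → y₁ ≡ y₂
  candidate-unique {y₁} {y₂} cand₁ cand₂ with y₁ ≟V y₂
  ... | yes y₁≡y₂ = y₁≡y₂
  ... | no y₁≢y₂ = ⊥-elim (no-three-common-neighbours Σ c₂ y-z-distance-2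
          (λ { refl → proj₂ cand₁ x∈ }) (λ { refl → proj₂ cand₂ x∈ }) y₁≢y₂
          (inj₂ xy , inj₁ xz) (candidate-common-neighbour cand₁) (candidate-common-neighbour cand₂))

  -- x ∈ P_{(a,1),(1,b)}(y, z), so by commutativity P_{(1,b),(a,1)}(y, z) has a
  -- member c; c = x would force ∂̃(y, x) = (1, b), i.e. a = b = 1.
  candidate-by-commutativity : ¬ (a ≡ 1 × b ≡ 1) → ∃ Candidate
  candidate-by-commutativity not-both
    with c , y→c , c→z ← Commutative⇒swap Γ comm {a , 1} {1 , b} x (swap x→y) x→z =
    c , (y→c , c→z) , c∉
    where
    c≢x : c ≢ x
    c≢x refl with DDist-functional Γ {1 , b} {a , 1} {y} {x} y→c (swap x→y)
    ... | refl = not-both (refl , refl)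
    c∉ : ¬ InΓᵢα c
    c∉ c∈ = layer-outsider-has-one-neighbour x∈ c∈ (c≢x ∘ sym) z∉
              (inj₁ xz) (inj₂ (Dist1⇒Arc Γ {z} {c} (proj₂ c→z)))

  candidate-of-undirected-edges : a ≡ 1 → b ≡ 1 → ∃ Candidate
  candidate-of-undirected-edges refl refl
    with w , w≢x , (yw , wz) ← another-common-neighbour Σ c₂ y-z-distance-2 {x} (inj₂ xy , inj₁ xz) =
    w , (y→w , swap z→w) , w∉
    where
    w∉ : ¬ InΓᵢα w
    w∉ w∈ = layer-outsider-has-one-neighbour x∈ w∈ (w≢x ∘ sym) z∉ (inj₁ xz) wz
    x≁w : ¬ x ~ w
    x≁w xw = layer-outsider-has-one-neighbour x∈ y∈ x≢y w∉ xw yw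
    x-w-distance-2 : Dist Σ 2 x w
    x-w-distance-2 = Dist2-intro Σ (λ { refl → w∉ x∈ }) x≁w (inj₁ xy) yw
    y→w : DDist Γ (1 , 1) y w
    y→w = undirected-edge-propagates sc comm c₂ x-w-distance-2 y≢z
            (inj₁ xy , yw) (inj₁ xz , Sum.swap wz) x→y x→z
    z→w : DDist Γ (1 , 1) z w
    z→w = undirected-edge-propagates sc comm c₂ x-w-distance-2 (y≢z ∘ sym)
            (inj₁ xz , Sum.swap wz) (inj₁ xy , yw) x→z x→y

  candidate-exists : ∃ Candidate
  candidate-exists with a ≟ 1 | b ≟ 1
  ... | yes a≡1 | yes b≡1 = candidate-of-undirected-edges a≡1 b≡1
  ... | no a≢1 | _ = candidate-by-commutativity (a≢1 ∘ proj₁)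
  ... | _ | no b≢1 = candidate-by-commutativity (b≢1 ∘ proj₂)

  ∃!-candidate : ∃! _≡_ Candidate
  ∃!-candidate with y′ , candidate ← candidate-exists = y′ , candidate , candidate-unique candidate

lemma3p7 : (q m' e : ℕ) → 2 ≤ q → (o : Fin q)
    → (Γ : Digraph q (suc m' + e))
    → WeaklyDistanceRegular Γ → Commutative Γ
    → DistanceRegular (underlying Γ)
    → Has-a₁ (underlying Γ) (q ∸ 2) → Has-c₂ (underlying Γ) 2
    → TopIsHamming {q} {suc m'} {e} Γ o
    → (i : Fin (suc m')) (β : Vec (Fin q) m')
    → (x y z : Vertex q (suc m' + e))
    → InLayer ((i ↑ˡ e)) (β ++ replicate e o) x
    → InLayer ((i ↑ˡ e)) (β ++ replicate e o) y
    → ¬ InLayer ((i ↑ˡ e)) (β ++ replicate e o) z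
    → (p : ℕ) → 2 ≤ p → DDist Γ (1 , p ∸ 1) x y
    → (s : ℕ) → 2 ≤ s → DDist Γ (1 , s ∸ 1) x z
    → ∃! _≡_ (λ y' → (DDist Γ (1 , s ∸ 1) y y' × DDist Γ (p ∸ 1 , 1) y' z)
                     × ¬ InLayer ((i ↑ˡ e)) (β ++ replicate e o) y')
lemma3p7 q m' e _ o Γ (sc , _) comm _ a₁ c₂ hamming i β x y z x∈ y∈ z∉ p _ x→y s _ x→z =
  Configuration.∃!-candidate sc comm a₁ c₂ hamming x∈ y∈ z∉ {p ∸ 1} {s ∸ 1} x→y x→z
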